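{- For any integer $n>7$, there is a permutation $\pi$ of $\{1,\ldots,n\}$ such that $\pi(1)=1$, $\pi(n)=n-1$, and $$\sum_{k=1}^{n-1}\frac{1}{\pi(k)-\pi(k+1)}=0.$$ -}

module Defs where

open import Data.Nat using (ℕ; zero; suc)
open import Data.Integer as ℤ using (ℤ; +_; -[1+_])
open import Data.Rational using (ℚ; _/_; 0ℚ; _+_)
open import Data.Fin using (Fin; toℕ; inject₁)
import Data.Fin as Fin

-- Reciprocal of an integer as a rational number.  The value at 0 is
-- fixed to 0 by convention; it is never used in the statement, since
-- consecutive values of a permutation are distinct.
recip : ℤ → ℚ
recip (+ zero)    = 0ℚ
recip (+ suc m)   = (+ 1) / suc m
recip -[1+ m ]    = ℤ.-[1+ 0 ] / suc m

sumFin : (m : ℕ) → (Fin m → ℚ) → ℚ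
sumFin zero    f = 0ℚ
sumFin (suc m) f = f Fin.zero + sumFin m (λ k → f (Fin.suc k))

val : ∀ {n} → (Fin n → Fin n) → Fin n → ℤ
val π i = + suc (toℕ (π i))

-- The sum  Σ_{k=1}^{n-1} 1 / (π(k) − π(k+1))  for a map on {1,…,n},
-- with n = suc m and positions k encoded 0-based as Fin (suc m).
reciprocalDiffSum : (m : ℕ) → (Fin (suc m) → Fin (suc m)) → ℚ
reciprocalDiffSum m π =
  sumFin m (λ k → recip (val π (inject₁ k) ℤ.- val π (Fin.suc k)))

-- Prepending the pattern 1, 3, 2 to a solution for n whose values are shifted
-- up by 3 gives a solution for n + 3: the new differences −2, 1, −2 (the last
-- one joining 2 to the shifted initial value 1 + 3) contribute
-- −1/2 + 1 − 1/2 = 0, and the old differences are unchanged by the shift.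
-- Explicit solutions for n = 8, 9, 10 start the induction.
module Submission where

open import Defs
open import Data.Nat using (ℕ; suc; _<_; _+_; _∸_)
open import Data.Nat.Properties using (m≤n⇒∃[o]m+o≡n)
open import Data.Fin using (Fin; toℕ; fromℕ; inject₁; #_)
open import Data.Fin.Patterns using (0F)
import Data.Fin as Fin
open import Data.Fin.Properties using (all?)
open import Data.Fin.Permutation using (Permutation′; _⟨$⟩ʳ_; permutation; lift₀; swap)
open import Data.Vec using (Vec; []; _∷_; lookup)
open import Data.Integer as ℤ using (+_; _⊖_)
open import Data.Integer.Properties using (m-n≡m⊖n; +-cancelˡ-⊖)
open import Data.Rational using (ℚ; 0ℚ; 1ℚ)
import Data.Rational as ℚ
open import Data.Rational.Properties using (+-assoc; +-identityˡ)
open import Data.Product using (Σ-syntax; _×_; _,_)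
open import Relation.Nullary.Decidable using (True; toWitness)
open import Relation.Binary.PropositionalEquality using (_≡_; refl; cong; cong₂; trans; sym; module ≡-Reasoning)

Solution : ℕ → Set
Solution m =
  Σ[ π ∈ Permutation′ (suc m) ] (toℕ (π ⟨$⟩ʳ 0F) ≡ 0
    × toℕ (π ⟨$⟩ʳ fromℕ m) ≡ m ∸ 1
    × reciprocalDiffSum m (π ⟨$⟩ʳ_) ≡ 0ℚ)

permutationFromTables : ∀ {n} (f g : Vec (Fin n) n) →
  {True (all? λ i → lookup f (lookup g i) Fin.≟ i)} →
  {True (all? λ i → lookup g (lookup f i) Fin.≟ i)} →
  Permutation′ n
permutationFromTables f g {fg} {gf} =
  permutation (lookup f) (lookup g) (toWitness fg) (toWitness gf)

sumFin-cong : ∀ m {a b : Fin m → ℚ} → (∀ k → a k ≡ b k) → sumFin m a ≡ sumFin m b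
sumFin-cong 0       a≡b = refl
sumFin-cong (suc m) a≡b = cong₂ ℚ._+_ (a≡b 0F) (sumFin-cong m (λ k → a≡b (Fin.suc k)))

[c+m]-[c+n]≡m-n : ∀ c m n → + (c + m) ℤ.- + (c + n) ≡ + m ℤ.- + n
[c+m]-[c+n]≡m-n c m n = begin
  + (c + m) ℤ.- + (c + n)  ≡⟨ m-n≡m⊖n (c + m) (c + n) ⟩
  (c + m) ⊖ (c + n)        ≡⟨ +-cancelˡ-⊖ c m n ⟩
  m ⊖ n                    ≡⟨ sym (m-n≡m⊖n m n) ⟩
  + m ℤ.- + n              ∎
  where open ≡-Reasoning

-- lift₀ (swap σ) maps 0, 1, 2 to 0, 2, 1 and 3 + k to 3 + σ k.
reciprocalDiffSum-lift₀-swap : ∀ m (σ : Permutation′ (suc m)) → toℕ (σ ⟨$⟩ʳ 0F) ≡ 0 →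
  reciprocalDiffSum (3 + m) (lift₀ (swap σ) ⟨$⟩ʳ_) ≡ reciprocalDiffSum m (σ ⟨$⟩ʳ_)
reciprocalDiffSum-lift₀-swap m σ σ0≡0 = begin
  −½ ℚ.+ (1ℚ ℚ.+ (recip (+ 2 ℤ.- + (4 + toℕ (σ ⟨$⟩ʳ 0F))) ℚ.+ shifted))
    ≡⟨ cong (λ v → −½ ℚ.+ (1ℚ ℚ.+ (recip (+ 2 ℤ.- + (4 + v)) ℚ.+ shifted))) σ0≡0 ⟩
  −½ ℚ.+ (1ℚ ℚ.+ (−½ ℚ.+ shifted))                 ≡⟨ sym (+-assoc −½ 1ℚ (−½ ℚ.+ shifted)) ⟩
  (−½ ℚ.+ 1ℚ) ℚ.+ (−½ ℚ.+ shifted)                ≡⟨ sym (+-assoc (−½ ℚ.+ 1ℚ) −½ shifted) ⟩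
  ((−½ ℚ.+ 1ℚ) ℚ.+ −½) ℚ.+ shifted                ≡⟨ +-identityˡ shifted ⟩
  shifted                                          ≡⟨ sumFin-cong m (λ k → cong recip
                                                        ([c+m]-[c+n]≡m-n 3 (value (inject₁ k)) (value (Fin.suc k)))) ⟩
  reciprocalDiffSum m (σ ⟨$⟩ʳ_)                    ∎
  where
  open ≡-Reasoning
  −½ : ℚ
  −½ = recip ℤ.-[1+ 1 ]
  value : Fin (suc m) → ℕ
  value i = suc (toℕ (σ ⟨$⟩ʳ i))
  shifted : ℚ
  shifted = sumFin m (λ k → recip (+ (3 + value (inject₁ k)) ℤ.- + (3 + value (Fin.suc k))))

extend : ∀ {m} → Solution (suc m) → Solution (3 + suc m)
extend {m} (σ , first , last , sum) =
  lift₀ (swap σ) , refl , cong (λ i → 3 + i) last ,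
  trans (reciprocalDiffSum-lift₀-swap (suc m) σ first) sum

solution8 : Solution 7
solution8 = permutationFromTables
  (# 0 ∷ # 1 ∷ # 3 ∷ # 7 ∷ # 5 ∷ # 4 ∷ # 2 ∷ # 6 ∷ [])
  (# 0 ∷ # 1 ∷ # 6 ∷ # 2 ∷ # 5 ∷ # 4 ∷ # 7 ∷ # 3 ∷ [])
  , refl , refl , refl

solution9 : Solution 8
solution9 = permutationFromTables
  (# 0 ∷ # 3 ∷ # 1 ∷ # 4 ∷ # 8 ∷ # 2 ∷ # 6 ∷ # 5 ∷ # 7 ∷ [])
  (# 0 ∷ # 2 ∷ # 5 ∷ # 1 ∷ # 3 ∷ # 7 ∷ # 6 ∷ # 8 ∷ # 4 ∷ [])
  , refl , refl , refl

solution10 : Solution 9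
solution10 = permutationFromTables
  (# 0 ∷ # 1 ∷ # 5 ∷ # 2 ∷ # 6 ∷ # 7 ∷ # 4 ∷ # 3 ∷ # 9 ∷ # 8 ∷ [])
  (# 0 ∷ # 1 ∷ # 3 ∷ # 7 ∷ # 6 ∷ # 2 ∷ # 4 ∷ # 5 ∷ # 9 ∷ # 8 ∷ [])
  , refl , refl , refl

solution : ∀ k → Solution (7 + k)
solution 0                   = solution8
solution 1                   = solution9
solution 2                   = solution10
solution (suc (suc (suc k))) = extend (solution k)

proposition2 : (m : ℕ) → 7 < suc m →
    Σ[ π ∈ Permutation′ (suc m) ] (toℕ ((π ⟨$⟩ʳ_) Data.Fin.zero) ≡ 0
      × toℕ ((π ⟨$⟩ʳ_) (Data.Fin.fromℕ m)) ≡ m Data.Nat.∸ 1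
      × reciprocalDiffSum m (π ⟨$⟩ʳ_) ≡ 0ℚ)
proposition2 m 7<1+m with m≤n⇒∃[o]m+o≡n 7<1+m
... | k , refl = solution k
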